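{- There does not exist a strong AMD code with $m\ge3$ sources and $\hat\epsilon<1$ that is simultaneously R-optimal and G-optimal.
   Context: Let $\mathcal{G}$ be a finite additive abelian group of order $n\ge2$ and $\mathcal{S}$ a set of $m$ sources. An AMD code consists of pairwise disjoint nonempty subsets $A(s)\subseteq\mathcal{G}$ ($s\in\mathcal{S}$) and a (possibly randomized) public encoding function $E$ mapping $s$ to some $g\in A(s)$ with probability $\Pr[E(s)=g]$. Write $a_s=|A(s)|$, $a=\sum_s a_s$. Strong security game for a source $s$: $s$ is given to the adversary, who chooses $\Delta\in\mathcal{G}\setminus\{0\}$ by a (possibly randomized) strategy depending on $s$; then $g=E(s)$; the adversary wins iff $g+\Delta\in A(s')$ for some $s'\ne s$. $\hat\epsilon_s$ is the maximum winning probability for source $s$, and $\hat\epsilon=\max_s\hat\epsilon_s$. The code is R-optimal if $\hat\epsilon_s=(a-a_s)/(n-1)$ for every $s$, and G-optimal if $\hat\epsilon_s=1/a_s$ for every $s$.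
   Formalization: The encoding probabilities $\Pr[E(s)=g]$ and the probabilities of the adversary's randomized strategies take values in the rationals. -}

module Defs where

open import Data.Nat as ℕ using (ℕ; zero; suc; _∸_; _≤_)
open import Data.Integer using (+_)
open import Data.Rational as ℚ using (ℚ; 0ℚ; 1ℚ)
open import Data.Fin using (Fin; _≟_)
open import Data.Fin.Subset using (Subset; _∈_; _∉_; ∣_∣; Nonempty)
open import Data.Vec using (lookup)
open import Data.Bool using (Bool; true; false; _∧_; not)
open import Data.List using (allFin)
open import Data.Bool.ListAction using (any)
open import Data.Product using (Σ; _×_; ∃)
open import Relation.Nullary using (¬_)
open import Relation.Nullary.Decidable using (⌊_⌋)
open import Relation.Binary.PropositionalEquality using (_≡_)
open import Algebra.Structures using (IsAbelianGroup)

sumFin : ∀ {n} → (Fin n → ℚ) → ℚ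
sumFin {zero}  f = 0ℚ
sumFin {suc n} f = f Data.Fin.zero ℚ.+ sumFin {n} (λ i → f (Data.Fin.suc i))

sumFinℕ : ∀ {m} → (Fin m → ℕ) → ℕ
sumFinℕ {zero}  f = 0
sumFinℕ {suc m} f = f Data.Fin.zero ℕ.+ sumFinℕ {m} (λ i → f (Data.Fin.suc i))

-- p / d as a rational (d = 0 never occurs where used; guarded value 0).
_/ℕ_ : ℕ → ℕ → ℚ
p /ℕ zero  = 0ℚ
p /ℕ suc d = (+ p) ℚ./ suc d

-- A finite additive abelian group whose carrier is enumerated as Fin n
-- (every finite abelian group of order n is isomorphic to such a one).
record FinAbGroup (n : ℕ) : Set where
  field
    _⊕_ : Fin n → Fin n → Fin n
    𝟘   : Fin n
    ⊖_  : Fin n → Fin n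
    isAbelianGroup : IsAbelianGroup _≡_ _⊕_ 𝟘 ⊖_

-- An AMD code over group G (order n) with m sources (sources = Fin m).
-- A s ⊆ G is the set of valid encodings of s; P s g = Pr[E(s) = g].
record AMDCode {n : ℕ} (G : FinAbGroup n) (m : ℕ) : Set where
  field
    A        : Fin m → Subset n
    nonempty : ∀ s → Nonempty (A s)
    disjoint : ∀ s s' → ¬ (s ≡ s') → ∀ g → g ∈ A s → g ∉ A s'
    P        : Fin m → Fin n → ℚ
    P-nonneg : ∀ s g → 0ℚ ℚ.≤ P s g
    P-sum    : ∀ s → sumFin (P s) ≡ 1ℚ
    P-supp   : ∀ s g → ¬ (P s g ≡ 0ℚ) → g ∈ A s

module _ {n : ℕ} {G : FinAbGroup n} {m : ℕ} (C : AMDCode G m) where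
  open FinAbGroup G
  open AMDCode C

  aₛ : Fin m → ℕ
  aₛ s = ∣ A s ∣

  aTot : ℕ
  aTot = sumFinℕ aₛ

  inOther : Fin m → Fin n → Bool
  inOther s h = any (λ s' → not ⌊ s' ≟ s ⌋ ∧ lookup (A s') h) (allFin m)

  ind : Bool → ℚ
  ind true  = 1ℚ
  ind false = 0ℚ

  winDet : Fin m → Fin n → ℚ
  winDet s Δ = sumFin (λ g → P s g ℚ.* ind (inOther s (g ⊕ Δ)))

  record Strategy : Set where
    field
      Q       : Fin n → ℚ
      Q-nonneg : ∀ Δ → 0ℚ ℚ.≤ Q Δ
      Q-zero  : Q 𝟘 ≡ 0ℚ
      Q-sum   : sumFin Q ≡ 1ℚ

  -- winning probability of a randomized strategy (independent of E's coins)
  win : Fin m → Strategy → ℚ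
  win s σ = sumFin (λ Δ → Strategy.Q σ Δ ℚ.* winDet s Δ)

  IsEpsHat : Fin m → ℚ → Set
  IsEpsHat s x = (∀ σ → win s σ ℚ.≤ x) × ∃ (λ σ → win s σ ≡ x)

  R-optimal : (Fin m → ℚ) → Set
  R-optimal ε = ∀ s → ε s ≡ (aTot ∸ aₛ s) /ℕ (n ∸ 1)

  G-optimal : (Fin m → ℚ) → Set
  G-optimal ε = ∀ s → ε s ≡ 1 /ℕ aₛ s

-- Point-mass strategies bound the success of every nonzero shift by ε̂_s, and shifting a
-- codeword g of s onto a codeword of another source gives Pr[E(s) = g] ≤ ε̂_s; since
-- a_s ε̂_s = 1 the encoding of s is uniform, so no shift carries two codewords of s into
-- other sources. Equating R- and G-optimality gives a_s (a - a_s) = n - 1, so counting the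
-- pairs (g, h) with g ∈ A(s) and h in another source shows that every nonzero shift carries
-- exactly one codeword of s into another source. Now let g ≠ g' in A(s) (a_s ≥ 2 as ε̂ < 1)
-- and Δ = g - g'. For every source t ≠ s the shift Δ carries some x ∈ A(t) into A(s).
-- Two sources t ≠ t' besides s give such x ≠ x', and then -Δ carries both x + Δ and x' + Δ
-- out of A(s).

{-# OPTIONS --safe #-}
module Submission where

open import Defs
open import Level using (0ℓ)
open import Function using (_∘_; Equivalence)
open import Algebra.Bundles using (AbelianGroup; Group)
import Algebra.Properties.AbelianGroup as AbelianGroupProperties
import Algebra.Properties.CommutativeSemigroup as CommutativeSemigroupProperties
import Algebra.Properties.Quasigroup as QuasigroupProperties
open import Data.Bool using (Bool; true; false; T; not; _∧_; if_then_else_)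
open import Data.Bool.Properties using (T-≡; T-∧)
open import Data.Empty using (⊥; ⊥-elim)
open import Data.Fin using (Fin; zero; suc; _≟_)
import Data.Fin.Properties as FinP
open import Data.Fin.Permutation using (Permutation; permutation)
open import Data.Fin.Subset using (Subset; _∈_; _∉_; ∣_∣)
open import Data.Integer using (+_)
import Data.Integer.Properties as ℤP
open import Data.Integer.Solver using (module +-*-Solver)
open import Data.List using (allFin)
open import Data.List.Membership.Propositional.Properties using (∈-allFin)
open import Data.List.Relation.Unary.Any as Any using ()
open import Data.List.Relation.Unary.Any.Properties using (any⁺; any⁻)
open import Data.Nat as ℕ using (ℕ; zero; suc; _≤_; _∸_; z≤n; s≤s)
import Data.Nat.Properties as ℕP
open import Data.Product using (Σ; _×_; _,_; ∃; ∃₂; proj₁)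
open import Data.Rational as ℚ using (ℚ; 0ℚ; 1ℚ; _<_; toℚᵘ)
import Data.Rational.Properties as ℚP
open import Data.Rational.Unnormalised using (mkℚᵘ; *≡*) renaming (_≃_ to _≃ᵘ_)
import Data.Rational.Unnormalised.Properties as ℚᵘP
open import Data.Vec using ([]; _∷_; lookup)
open import Data.Vec.Properties using ([]=⇒lookup; lookup⇒[]=)
open import Relation.Binary.PropositionalEquality
open import Relation.Nullary using (¬_; yes; no)
open import Relation.Nullary.Decidable using (⌊_⌋; fromWitnessFalse; toWitnessFalse)

open import Algebra.Properties.Semiring.Sum ℕP.+-*-semiring
  using (sum; sum-syntax; sum-cong-≗; ∑-comm; ∑-permute; ∑-distrib-+;
         *-distribˡ-sum; *-distribʳ-sum)

open Equivalence using (to; from)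

sumFinℕ≡sum : ∀ {n} (f : Fin n → ℕ) → sumFinℕ f ≡ sum f
sumFinℕ≡sum {zero}  f = refl
sumFinℕ≡sum {suc n} f = cong (f zero ℕ.+_) (sumFinℕ≡sum (f ∘ suc))

sum-mono-≤ : ∀ {n} {f g : Fin n → ℕ} → (∀ i → f i ≤ g i) → sum f ≤ sum g
sum-mono-≤ {zero}  f≤g = z≤n
sum-mono-≤ {suc n} f≤g = ℕP.+-mono-≤ (f≤g zero) (sum-mono-≤ (f≤g ∘ suc))

term≤sum : ∀ {n} (f : Fin n → ℕ) i → f i ≤ sum f
term≤sum f zero    = ℕP.m≤m+n _ _
term≤sum f (suc i) = ℕP.≤-trans (term≤sum (f ∘ suc) i) (ℕP.m≤n+m _ (f zero))

≤1⇒sum≤n : ∀ {n} {f : Fin n → ℕ} → (∀ i → f i ≤ 1) → sum f ≤ n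
≤1⇒sum≤n {zero}  f≤1 = z≤n
≤1⇒sum≤n {suc n} f≤1 = ℕP.+-mono-≤ (f≤1 zero) (≤1⇒sum≤n (f≤1 ∘ suc))

≤1⇒sum<n : ∀ {n} {f : Fin n → ℕ} → (∀ i → f i ≤ 1) → ∀ i → f i ≡ 0 → sum f ℕ.< n
≤1⇒sum<n f≤1 zero fi≡0 rewrite fi≡0 = s≤s (≤1⇒sum≤n (f≤1 ∘ suc))
≤1⇒sum<n {suc n} {f} f≤1 (suc i) fi≡0 =
  subst (ℕ._≤ suc n) (ℕP.+-suc (f zero) _) (ℕP.+-mono-≤ (f≤1 zero) (≤1⇒sum<n (f≤1 ∘ suc) i fi≡0))

≤1⇒suc-sum<n : ∀ {n} {f : Fin n → ℕ} → (∀ i → f i ≤ 1) →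
               ∀ {i j} → i ≢ j → f i ≡ 0 → f j ≡ 0 → suc (sum f) ℕ.< n
≤1⇒suc-sum<n _ {zero} {zero} i≢j _ _ = ⊥-elim (i≢j refl)
≤1⇒suc-sum<n f≤1 {zero} {suc j} _ fi≡0 fj≡0 rewrite fi≡0 =
  s≤s (≤1⇒sum<n (f≤1 ∘ suc) j fj≡0)
≤1⇒suc-sum<n f≤1 {suc i} {zero} _ fi≡0 fj≡0 rewrite fj≡0 =
  s≤s (≤1⇒sum<n (f≤1 ∘ suc) i fi≡0)
≤1⇒suc-sum<n {suc n} {f} f≤1 {suc i} {suc j} i≢j fi≡0 fj≡0 =
  subst (ℕ._≤ suc n) (trans (ℕP.+-suc (f zero) _) (cong suc (ℕP.+-suc (f zero) _)))
    (ℕP.+-mono-≤ (f≤1 zero) (≤1⇒suc-sum<n (f≤1 ∘ suc) (i≢j ∘ cong suc) fi≡0 fj≡0))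

≤1⇒zero-unique : ∀ {n} {f : Fin n → ℕ} → (∀ i → f i ≤ 1) → n ∸ 1 ≤ sum f →
                 ∀ {i j} → f i ≡ 0 → f j ≡ 0 → i ≡ j
≤1⇒zero-unique {n} f≤1 n∸1≤sum {i} {j} fi≡0 fj≡0 with i ≟ j
... | yes i≡j = i≡j
... | no i≢j  = ⊥-elim (ℕP.<-irrefl refl (ℕP.≤-trans (≤1⇒suc-sum<n f≤1 i≢j fi≡0 fj≡0)
                                                  (ℕP.≤-trans (ℕP.m≤n+m∸n n 1) (s≤s n∸1≤sum))))

𝟙 : Bool → ℕ
𝟙 true  = 1
𝟙 false = 0

𝟙-∧ : ∀ a b → 𝟙 (a ∧ b) ≡ 𝟙 a ℕ.* 𝟙 b
𝟙-∧ true  b = sym (ℕP.+-identityʳ (𝟙 b))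
𝟙-∧ false b = refl

T⇒1≤𝟙 : ∀ {b} → T b → 1 ≤ 𝟙 b
T⇒1≤𝟙 {true} _ = s≤s z≤n

count : ∀ {n} → (Fin n → Bool) → ℕ
count b = sum (𝟙 ∘ b)

∣p∣≡count : ∀ {n} (p : Subset n) → ∣ p ∣ ≡ count (lookup p)
∣p∣≡count []          = refl
∣p∣≡count (true ∷ p)  = cong suc (∣p∣≡count p)
∣p∣≡count (false ∷ p) = ∣p∣≡count p

count-none : ∀ {n} (b : Fin n → Bool) → (∀ i → ¬ T (b i)) → count b ≡ 0
count-none {zero}  b none = refl
count-none {suc n} b none with b zero in b₀
... | true  = ⊥-elim (none zero (from T-≡ b₀))
... | false = count-none (b ∘ suc) (none ∘ suc)

count-≤1 : ∀ {n} (b : Fin n → Bool) → (∀ i j → T (b i) → T (b j) → i ≡ j) → count b ≤ 1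
count-≤1 {zero}  b unique = z≤n
count-≤1 {suc n} b unique with b zero in b₀
... | true  = ℕP.≤-reflexive (cong suc (count-none (b ∘ suc) λ i bᵢ →
                FinP.0≢1+n (unique zero (suc i) (from T-≡ b₀) bᵢ)))
... | false = count-≤1 (b ∘ suc) (λ i j bᵢ bⱼ → FinP.suc-injective (unique (suc i) (suc j) bᵢ bⱼ))

count-witness : ∀ {n} (b : Fin n → Bool) → 0 ℕ.< count b → ∃ λ i → T (b i)
count-witness {suc n} b 0<count with b zero in b₀
... | true  = zero , from T-≡ b₀
... | false = let i , bᵢ = count-witness (b ∘ suc) 0<count in suc i , bᵢ

count-two-witnesses : ∀ {n} (b : Fin n → Bool) → 1 ℕ.< count b →
                      ∃₂ λ i j → i ≢ j × T (b i) × T (b j)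
count-two-witnesses {suc n} b 1<count with b zero in b₀
... | true  = let j , bⱼ = count-witness (b ∘ suc) (ℕP.≤-pred 1<count)
              in zero , suc j , (λ ()) , from T-≡ b₀ , bⱼ
... | false = let i , j , i≢j , bᵢ , bⱼ = count-two-witnesses (b ∘ suc) 1<count
              in suc i , suc j , i≢j ∘ FinP.suc-injective , bᵢ , bⱼ

∈⇒T : ∀ {n} {p : Subset n} {i} → i ∈ p → T (lookup p i)
∈⇒T i∈p = from T-≡ ([]=⇒lookup i∈p)

T⇒∈ : ∀ {n} {p : Subset n} {i} → T (lookup p i) → i ∈ p
T⇒∈ {p = p} {i} t = lookup⇒[]= i p (to T-≡ t)

sumFin-cong : ∀ {n} {f g : Fin n → ℚ} → (∀ i → f i ≡ g i) → sumFin f ≡ sumFin g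
sumFin-cong {zero}  f≡g = refl
sumFin-cong {suc n} f≡g = cong₂ ℚ._+_ (f≡g zero) (sumFin-cong (f≡g ∘ suc))

sumFin-zero : ∀ n → sumFin {n} (λ _ → 0ℚ) ≡ 0ℚ
sumFin-zero zero    = refl
sumFin-zero (suc n) = cong (0ℚ ℚ.+_) (sumFin-zero n)

sumFin-nonneg : ∀ {n} {f : Fin n → ℚ} → (∀ i → 0ℚ ℚ.≤ f i) → 0ℚ ℚ.≤ sumFin f
sumFin-nonneg {zero}  f≥0 = ℚP.≤-refl
sumFin-nonneg {suc n} f≥0 = ℚP.+-mono-≤ (f≥0 zero) (sumFin-nonneg (f≥0 ∘ suc))

sumFin-mono-≤ : ∀ {n} {f g : Fin n → ℚ} → (∀ i → f i ℚ.≤ g i) → sumFin f ℚ.≤ sumFin g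
sumFin-mono-≤ {zero}  f≤g = ℚP.≤-refl
sumFin-mono-≤ {suc n} f≤g = ℚP.+-mono-≤ (f≤g zero) (sumFin-mono-≤ (f≤g ∘ suc))

sumFin-mono-< : ∀ {n} {f g : Fin n → ℚ} → (∀ i → f i ℚ.≤ g i) →
                ∀ j → f j < g j → sumFin f < sumFin g
sumFin-mono-< f≤g zero    fⱼ<gⱼ = ℚP.+-mono-<-≤ fⱼ<gⱼ (sumFin-mono-≤ (f≤g ∘ suc))
sumFin-mono-< f≤g (suc j) fⱼ<gⱼ = ℚP.+-mono-≤-< (f≤g zero) (sumFin-mono-< (f≤g ∘ suc) j fⱼ<gⱼ)

sumFin-≤-equal : ∀ {n} {f g : Fin n → ℚ} → (∀ i → f i ℚ.≤ g i) → sumFin f ≡ sumFin g →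
                 ∀ i → f i ≡ g i
sumFin-≤-equal f≤g Σf≡Σg i =
  ℚP.≤-antisym (f≤g i) (ℚP.≮⇒≥ (λ fᵢ<gᵢ → ℚP.<-irrefl Σf≡Σg (sumFin-mono-< f≤g i fᵢ<gᵢ)))

term≤sumFin : ∀ {n} {f : Fin n → ℚ} → (∀ i → 0ℚ ℚ.≤ f i) → ∀ i → f i ℚ.≤ sumFin f
term≤sumFin {f = f} f≥0 zero =
  subst (ℚ._≤ sumFin f) (ℚP.+-identityʳ (f zero))
    (ℚP.+-mono-≤ (ℚP.≤-refl {f zero}) (sumFin-nonneg (f≥0 ∘ suc)))
term≤sumFin {f = f} f≥0 (suc i) =
  subst (ℚ._≤ sumFin f) (ℚP.+-identityˡ (f (suc i)))
    (ℚP.+-mono-≤ (f≥0 zero) (term≤sumFin (f≥0 ∘ suc) i))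

two-terms≤sumFin : ∀ {n} {f : Fin n → ℚ} → (∀ i → 0ℚ ℚ.≤ f i) →
                   ∀ {i j} → i ≢ j → f i ℚ.+ f j ℚ.≤ sumFin f
two-terms≤sumFin f≥0 {zero} {zero} i≢j = ⊥-elim (i≢j refl)
two-terms≤sumFin {f = f} f≥0 {zero} {suc j} _ =
  ℚP.+-mono-≤ (ℚP.≤-refl {f zero}) (term≤sumFin (f≥0 ∘ suc) j)
two-terms≤sumFin {f = f} f≥0 {suc i} {zero} _ =
  subst (ℚ._≤ sumFin f) (ℚP.+-comm (f zero) (f (suc i)))
    (ℚP.+-mono-≤ (ℚP.≤-refl {f zero}) (term≤sumFin (f≥0 ∘ suc) i))
two-terms≤sumFin {f = f} f≥0 {suc i} {suc j} i≢j =
  subst (ℚ._≤ sumFin f) (ℚP.+-identityˡ _)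
    (ℚP.+-mono-≤ (f≥0 zero) (two-terms≤sumFin (f≥0 ∘ suc) (i≢j ∘ cong suc)))

pointMass : ∀ {n} → Fin n → Fin n → ℚ
pointMass zero    zero    = 1ℚ
pointMass zero    (suc _) = 0ℚ
pointMass (suc _) zero    = 0ℚ
pointMass (suc i) (suc j) = pointMass i j

pointMass-nonneg : ∀ {n} (i j : Fin n) → 0ℚ ℚ.≤ pointMass i j
pointMass-nonneg zero    zero    = ℚP.nonNegative⁻¹ 1ℚ
pointMass-nonneg zero    (suc _) = ℚP.≤-refl
pointMass-nonneg (suc _) zero    = ℚP.≤-refl
pointMass-nonneg (suc i) (suc j) = pointMass-nonneg i j

pointMass-≢ : ∀ {n} {i j : Fin n} → i ≢ j → pointMass i j ≡ 0ℚ
pointMass-≢ {i = zero}  {zero}  i≢j = ⊥-elim (i≢j refl)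
pointMass-≢ {i = zero}  {suc _} _   = refl
pointMass-≢ {i = suc _} {zero}  _   = refl
pointMass-≢ {i = suc i} {suc j} i≢j = pointMass-≢ (i≢j ∘ cong suc)

sumFin-pointMass-* : ∀ {n} (i : Fin n) (f : Fin n → ℚ) → sumFin (λ j → pointMass i j ℚ.* f j) ≡ f i
sumFin-pointMass-* {suc n} zero f = begin
  1ℚ ℚ.* f zero ℚ.+ sumFin (λ j → 0ℚ ℚ.* f (suc j))
    ≡⟨ cong₂ ℚ._+_ (ℚP.*-identityˡ (f zero)) (sumFin-cong (λ j → ℚP.*-zeroˡ (f (suc j)))) ⟩
  f zero ℚ.+ sumFin {n} (λ _ → 0ℚ)  ≡⟨ cong (f zero ℚ.+_) (sumFin-zero n) ⟩
  f zero ℚ.+ 0ℚ                     ≡⟨ ℚP.+-identityʳ (f zero) ⟩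
  f zero                            ∎
  where open ≡-Reasoning
sumFin-pointMass-* (suc i) f = begin
  0ℚ ℚ.* f zero ℚ.+ rest  ≡⟨ cong (ℚ._+ rest) (ℚP.*-zeroˡ (f zero)) ⟩
  0ℚ ℚ.+ rest             ≡⟨ ℚP.+-identityˡ rest ⟩
  rest                    ≡⟨ sumFin-pointMass-* i (f ∘ suc) ⟩
  f (suc i)               ∎
  where
  open ≡-Reasoning
  rest = sumFin (λ j → pointMass i j ℚ.* f (suc j))

sumFin-pointMass : ∀ {n} (i : Fin n) → sumFin (pointMass i) ≡ 1ℚ
sumFin-pointMass i = trans (sumFin-cong (λ j → sym (ℚP.*-identityʳ (pointMass i j))))
                           (sumFin-pointMass-* i (λ _ → 1ℚ))

-- Computed in ℚᵘ, where 1 /ℕ suc k is fromℚᵘ (mkℚᵘ (+ 1) k) and fractions over the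
-- common denominator add by a ring identity.
toℚᵘ-sumFin-if : ∀ {n} (b : Fin n → Bool) k →
                 toℚᵘ (sumFin (λ i → if b i then 1 /ℕ suc k else 0ℚ)) ≃ᵘ mkℚᵘ (+ count b) k
toℚᵘ-sumFin-if {zero}  b k = *≡* refl
toℚᵘ-sumFin-if {suc n} b k with b zero
... | false = ℚᵘP.≃-trans (ℚᵘP.≃-reflexive (cong toℚᵘ (ℚP.+-identityˡ _)))
                          (toℚᵘ-sumFin-if (b ∘ suc) k)
... | true  = ℚᵘP.≃-trans (ℚP.toℚᵘ-homo-+ (1 /ℕ suc k) _)
                (ℚᵘP.≃-trans (ℚᵘP.+-cong (ℚP.toℚᵘ-fromℚᵘ (mkℚᵘ (+ 1) k)) (toℚᵘ-sumFin-if (b ∘ suc) k))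
                   (*≡* (solve 2 (λ c d → (con (+ 1) :* d :+ c :* d) :* d := (con (+ 1) :+ c) :* (d :* d))
                                 refl (+ count (b ∘ suc)) (+ suc k))))
  where open +-*-Solver

sumFin-if-1/count : ∀ {n} (b : Fin n → Bool) → 0 ℕ.< count b →
                    sumFin (λ i → if b i then 1 /ℕ count b else 0ℚ) ≡ 1ℚ
sumFin-if-1/count b 0<count with count b | toℚᵘ-sumFin-if b
... | suc k | Σ≃ = ℚP.toℚᵘ-injective (ℚᵘP.≃-trans (Σ≃ k) (*≡* (ℤP.*-comm (+ suc k) (+ 1))))

1/ℕ-pos : ∀ {k} → 0 ℕ.< k → 0ℚ < 1 /ℕ k
1/ℕ-pos {suc k} _ = ℚP.positive⁻¹ (1 /ℕ suc k) {{ℚP.normalize-pos 1 (suc k)}}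

1/ℕ<1⇒1<k : ∀ {k} → 0 ℕ.< k → 1 /ℕ k < 1ℚ → 1 ℕ.< k
1/ℕ<1⇒1<k {suc zero}    _ 1<1 = ⊥-elim (ℚP.<-irrefl refl 1<1)
1/ℕ<1⇒1<k {suc (suc k)} _ _   = s≤s (s≤s z≤n)

1/x≡b/y⇒y≡b*x : ∀ {x y} b → 0 ℕ.< x → 0 ℕ.< y → 1 /ℕ x ≡ b /ℕ y → y ≡ b ℕ.* x
1/x≡b/y⇒y≡b*x {suc x} {suc y} b _ _ eq =
  trans (sym (ℕP.*-identityˡ (suc y))) (ℚP.normalize-injective-≃ 1 b (suc x) (suc y) eq)

abelianGroup : ∀ {n} → FinAbGroup n → AbelianGroup 0ℓ 0ℓ
abelianGroup G = record { isAbelianGroup = FinAbGroup.isAbelianGroup G }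

module _ {n} (G : FinAbGroup n) where
  open FinAbGroup G
  open Group (AbelianGroup.group (abelianGroup G)) using (_\\_; identityʳ)
  open AbelianGroupProperties (abelianGroup G) using (\\-leftDividesˡ; \\-leftDividesʳ)

  translation : Fin n → Permutation n n
  translation g = permutation (g ⊕_) (λ h → g \\ h) (\\-leftDividesˡ g) (\\-leftDividesʳ g)

  sum-translate : ∀ (f : Fin n → ℕ) g → ∑[ d < n ] f (g ⊕ d) ≡ sum f
  sum-translate f g = sym (∑-permute f (translation g))

  x\\y≡𝟘⇒x≡y : ∀ {x y} → x \\ y ≡ 𝟘 → x ≡ y
  x\\y≡𝟘⇒x≡y {x} {y} x\\y≡𝟘 = sym (begin
    y            ≡⟨ \\-leftDividesˡ x y ⟨
    x ⊕ (x \\ y) ≡⟨ cong (x ⊕_) x\\y≡𝟘 ⟩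
    x ⊕ 𝟘        ≡⟨ identityʳ x ⟩
    x            ∎)
    where open ≡-Reasoning

module _ {n m} {G : FinAbGroup n} (C : AMDCode G m) where
  open FinAbGroup G
  open AMDCode C
  open Group (AbelianGroup.group (abelianGroup G)) using (identityʳ)

  InOther : Fin m → Fin n → Set
  InOther s h = T (inOther C s h)

  other-intro : ∀ {s t h} → t ≢ s → h ∈ A t → InOther s h
  other-intro {t = t} t≢s h∈Aₜ =
    any⁺ _ (Any.map (λ { refl → from T-∧ (fromWitnessFalse t≢s , ∈⇒T h∈Aₜ) }) (∈-allFin t))

  other-elim : ∀ {s h} → InOther s h → ∃ λ t → t ≢ s × h ∈ A t
  other-elim {s} {h} o =
    let t , pₜ     = Any.satisfied (any⁻ (λ t → not ⌊ t ≟ s ⌋ ∧ lookup (A t) h) (allFin m) o)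
        t≢s , h∈Aₜ = to T-∧ pₜ
    in t , toWitnessFalse t≢s , T⇒∈ h∈Aₜ

  own-not-other : ∀ {s h} → h ∈ A s → ¬ InOther s h
  own-not-other {s} {h} h∈Aₛ o = let t , t≢s , h∈Aₜ = other-elim o
                                 in disjoint s t (t≢s ∘ sym) h h∈Aₛ h∈Aₜ

  hit⇒≢𝟘 : ∀ {s g d} → g ∈ A s → InOther s (g ⊕ d) → d ≢ 𝟘
  hit⇒≢𝟘 {s} {g} g∈Aₛ hit d≡𝟘 =
    own-not-other g∈Aₛ (subst (InOther s) (trans (cong (g ⊕_) d≡𝟘) (identityʳ g)) hit)

  P-outside : ∀ {s h} → h ∉ A s → P s h ≡ 0ℚ
  P-outside {s} {h} h∉Aₛ with P s h ℚP.≟ 0ℚ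
  ... | yes P≡0 = P≡0
  ... | no  P≢0 = ⊥-elim (h∉Aₛ (P-supp s h P≢0))

  pointStrategy : ∀ {d} → d ≢ 𝟘 → Strategy C
  pointStrategy {d} d≢𝟘 = record
    { Q        = pointMass d
    ; Q-nonneg = pointMass-nonneg d
    ; Q-zero   = pointMass-≢ d≢𝟘
    ; Q-sum    = sumFin-pointMass d
    }

  win-pointStrategy : ∀ s {d} (d≢𝟘 : d ≢ 𝟘) → win C s (pointStrategy d≢𝟘) ≡ winDet C s d
  win-pointStrategy s {d} _ = sumFin-pointMass-* d (winDet C s)

  hit-nonneg : ∀ s d g → 0ℚ ℚ.≤ P s g ℚ.* ind C (inOther C s (g ⊕ d))
  hit-nonneg s d g with inOther C s (g ⊕ d)
  ... | true  = subst (0ℚ ℚ.≤_) (sym (ℚP.*-identityʳ (P s g))) (P-nonneg s g)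
  ... | false = ℚP.≤-reflexive (sym (ℚP.*-zeroʳ (P s g)))

  hit-term : ∀ {s d g} → InOther s (g ⊕ d) → P s g ℚ.* ind C (inOther C s (g ⊕ d)) ≡ P s g
  hit-term {s} {d} {g} hit with inOther C s (g ⊕ d)
  ... | true = ℚP.*-identityʳ (P s g)

  P≤winDet : ∀ {s d g} → InOther s (g ⊕ d) → P s g ℚ.≤ winDet C s d
  P≤winDet {s} {d} {g} hit =
    subst (ℚ._≤ winDet C s d) (hit-term hit) (term≤sumFin (hit-nonneg s d) g)

  P+P≤winDet : ∀ {s d g g'} → g ≢ g' → InOther s (g ⊕ d) → InOther s (g' ⊕ d) →
               P s g ℚ.+ P s g' ℚ.≤ winDet C s d
  P+P≤winDet {s} {d} g≢g' hit hit' =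
    subst (ℚ._≤ winDet C s d) (cong₂ ℚ._+_ (hit-term hit) (hit-term hit'))
      (two-terms≤sumFin (hit-nonneg s d) g≢g')

  aₛ≡count : ∀ s → aₛ C s ≡ count (lookup (A s))
  aₛ≡count s = ∣p∣≡count (A s)

  0<aₛ : ∀ s → 0 ℕ.< aₛ C s
  0<aₛ s = let g , g∈Aₛ = nonempty s
           in subst (0 ℕ.<_) (sym (aₛ≡count s)) (ℕP.≤-trans (T⇒1≤𝟙 (∈⇒T g∈Aₛ)) (term≤sum _ g))

  sources-containing≤ : ∀ t h →
                        count (λ s → lookup (A s) h) ≤ 𝟙 (lookup (A t) h) ℕ.+ 𝟙 (inOther C t h)
  sources-containing≤ t h with 1 ℕ.≤? count (λ s → lookup (A s) h)
  ... | no  count≱1 = ℕP.≤-trans (ℕP.≤-pred (ℕP.≰⇒> count≱1)) z≤n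
  ... | yes count≥1 = ℕP.≤-trans (count-≤1 _ same-source) (covered (count-witness _ count≥1))
    where
    same-source : ∀ s s' → T (lookup (A s) h) → T (lookup (A s') h) → s ≡ s'
    same-source s s' h∈Aₛ h∈Aₛ' with s ≟ s'
    ... | yes s≡s' = s≡s'
    ... | no  s≢s' = ⊥-elim (disjoint s s' s≢s' h (T⇒∈ h∈Aₛ) (T⇒∈ h∈Aₛ'))
    covered : (∃ λ s → T (lookup (A s) h)) → 1 ≤ 𝟙 (lookup (A t) h) ℕ.+ 𝟙 (inOther C t h)
    covered (s , h∈Aₛ) with s ≟ t
    ... | yes refl = ℕP.≤-trans (T⇒1≤𝟙 h∈Aₛ) (ℕP.m≤m+n _ _)
    ... | no  s≢t  = ℕP.≤-trans (T⇒1≤𝟙 (other-intro s≢t (T⇒∈ h∈Aₛ))) (ℕP.m≤n+m _ _)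

  aTot≤aₛ+others : ∀ t → aTot C ≤ aₛ C t ℕ.+ count (inOther C t)
  aTot≤aₛ+others t = begin
    aTot C                                                  ≡⟨ sumFinℕ≡sum (aₛ C) ⟩
    ∑[ s < m ] aₛ C s                                       ≡⟨ sum-cong-≗ aₛ≡count ⟩
    ∑[ s < m ] ∑[ h < n ] 𝟙 (lookup (A s) h)                ≡⟨ ∑-comm (λ s h → 𝟙 (lookup (A s) h)) ⟩
    ∑[ h < n ] count (λ s → lookup (A s) h)                 ≤⟨ sum-mono-≤ (sources-containing≤ t) ⟩
    ∑[ h < n ] (𝟙 (lookup (A t) h) ℕ.+ 𝟙 (inOther C t h))  ≡⟨ ∑-distrib-+ (𝟙 ∘ lookup (A t)) (𝟙 ∘ inOther C t) ⟩
    count (lookup (A t)) ℕ.+ count (inOther C t)            ≡⟨ cong (ℕ._+ count (inOther C t)) (aₛ≡count t) ⟨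
    aₛ C t ℕ.+ count (inOther C t)                          ∎
    where open ℕP.≤-Reasoning

module Optimal {n m} {G : FinAbGroup n} (C : AMDCode G m) {ε : Fin m → ℚ}
               (ε-max : ∀ s → IsEpsHat C s (ε s)) (G-opt : G-optimal C ε)
               (another : ∀ (s : Fin m) → ∃ λ t → t ≢ s) where
  open FinAbGroup G
  open AMDCode C
  open Group (AbelianGroup.group (abelianGroup G)) using (_\\_; identityʳ)
  open AbelianGroupProperties (abelianGroup G) using (\\-leftDividesˡ; //-rightDividesʳ; quasigroup)
  open CommutativeSemigroupProperties (AbelianGroup.commutativeSemigroup (abelianGroup G))
    using (x∙yz≈z∙yx)
  open QuasigroupProperties quasigroup using (cancelʳ)

  winDet≤ε : ∀ s {d} → d ≢ 𝟘 → winDet C s d ℚ.≤ ε s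
  winDet≤ε s d≢𝟘 =
    subst (ℚ._≤ ε s) (win-pointStrategy C s d≢𝟘) (proj₁ (ε-max s) (pointStrategy C d≢𝟘))

  P≤ε : ∀ {s g} → g ∈ A s → P s g ℚ.≤ ε s
  P≤ε {s} {g} g∈Aₛ with another s
  ... | t , t≢s with nonempty t
  ... | h , h∈Aₜ = ℚP.≤-trans (P≤winDet C hit) (winDet≤ε s (hit⇒≢𝟘 C g∈Aₛ hit))
    where
    hit : InOther C s (g ⊕ (g \\ h))
    hit = subst (InOther C s) (sym (\\-leftDividesˡ g h)) (other-intro C t≢s h∈Aₜ)

  -- P s ≤ ε s on A s, and both have total mass 1 there because a_s ε s = 1.
  P≡ε : ∀ {s g} → g ∈ A s → P s g ≡ ε s
  P≡ε {s} {g} g∈Aₛ = trans (sumFin-≤-equal P≤bound (trans (P-sum s) (sym Σbound≡1)) g)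
                           (cong (λ b → if b then ε s else 0ℚ) ([]=⇒lookup g∈Aₛ))
    where
    bound : Fin n → ℚ
    bound h = if lookup (A s) h then ε s else 0ℚ
    P≤bound : ∀ h → P s h ℚ.≤ bound h
    P≤bound h with lookup (A s) h in h∈?Aₛ
    ... | true  = P≤ε (lookup⇒[]= h (A s) h∈?Aₛ)
    ... | false = ℚP.≤-reflexive (P-outside C (λ h∈Aₛ → subst T h∈?Aₛ (∈⇒T h∈Aₛ)))
    Σbound≡1 : sumFin bound ≡ 1ℚ
    Σbound≡1 = trans (sumFin-cong (λ h → cong (λ e → if lookup (A s) h then e else 0ℚ)
                                          (trans (G-opt s) (cong (1 /ℕ_) (aₛ≡count C s)))))
                     (sumFin-if-1/count (lookup (A s)) (subst (0 ℕ.<_) (aₛ≡count C s) (0<aₛ C s)))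

  ε-pos : ∀ s → 0ℚ < ε s
  ε-pos s = subst (0ℚ <_) (sym (G-opt s)) (1/ℕ-pos (0<aₛ C s))

  collision-free : ∀ {s d g g'} → g ∈ A s → g' ∈ A s →
                   InOther C s (g ⊕ d) → InOther C s (g' ⊕ d) → g ≡ g'
  collision-free {s} {d} {g} {g'} g∈Aₛ g'∈Aₛ hit hit' with g ≟ g'
  ... | yes g≡g' = g≡g'
  ... | no  g≢g' = ⊥-elim (ℚP.<-irrefl refl (begin-strict
    ε s               <⟨ ε<ε+ε ⟩
    ε s ℚ.+ ε s       ≡⟨ cong₂ ℚ._+_ (P≡ε g∈Aₛ) (P≡ε g'∈Aₛ) ⟨
    P s g ℚ.+ P s g'  ≤⟨ P+P≤winDet C g≢g' hit hit' ⟩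
    winDet C s d      ≤⟨ winDet≤ε s (hit⇒≢𝟘 C g∈Aₛ hit) ⟩
    ε s               ∎))
    where
    open ℚP.≤-Reasoning
    ε<ε+ε : ε s < ε s ℚ.+ ε s
    ε<ε+ε = subst (_< ε s ℚ.+ ε s) (ℚP.+-identityʳ (ε s))
                  (ℚP.+-mono-≤-< (ℚP.≤-refl {ε s}) (ε-pos s))

  module _ (R-opt : R-optimal C ε) (2≤n : 2 ≤ n) where

    hits : Fin m → Fin n → ℕ
    hits t d = count (λ g → lookup (A t) g ∧ inOther C t (g ⊕ d))

    hits≤1 : ∀ t d → hits t d ≤ 1
    hits≤1 t d = count-≤1 _ λ g g' hit hit' →
      let g∈Aₜ , o = to T-∧ hit ; g'∈Aₜ , o' = to T-∧ hit'
      in collision-free (T⇒∈ g∈Aₜ) (T⇒∈ g'∈Aₜ) o o'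

    hits-𝟘 : ∀ t → hits t 𝟘 ≡ 0
    hits-𝟘 t = count-none (λ g → lookup (A t) g ∧ inOther C t (g ⊕ 𝟘)) λ g hit →
      let g∈Aₜ , o = to T-∧ hit in hit⇒≢𝟘 C (T⇒∈ g∈Aₜ) o refl

    sum-hits : ∀ t → sum (hits t) ≡ aₛ C t ℕ.* count (inOther C t)
    sum-hits t = begin
      ∑[ d < n ] ∑[ g < n ] 𝟙 (lookup (A t) g ∧ inOther C t (g ⊕ d))
        ≡⟨ sum-cong-≗ (λ d → sum-cong-≗ (λ g → 𝟙-∧ (lookup (A t) g) (inOther C t (g ⊕ d)))) ⟩
      ∑[ d < n ] ∑[ g < n ] (𝟙 (lookup (A t) g) ℕ.* 𝟙 (inOther C t (g ⊕ d)))
        ≡⟨ ∑-comm (λ d g → 𝟙 (lookup (A t) g) ℕ.* 𝟙 (inOther C t (g ⊕ d))) ⟩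
      ∑[ g < n ] ∑[ d < n ] (𝟙 (lookup (A t) g) ℕ.* 𝟙 (inOther C t (g ⊕ d)))
        ≡⟨ sum-cong-≗ (λ g → *-distribˡ-sum (𝟙 (lookup (A t) g)) (λ d → 𝟙 (inOther C t (g ⊕ d)))) ⟨
      ∑[ g < n ] (𝟙 (lookup (A t) g) ℕ.* ∑[ d < n ] 𝟙 (inOther C t (g ⊕ d)))
        ≡⟨ sum-cong-≗ (λ g → cong (𝟙 (lookup (A t) g) ℕ.*_) (sum-translate G (𝟙 ∘ inOther C t) g)) ⟩
      ∑[ g < n ] (𝟙 (lookup (A t) g) ℕ.* count (inOther C t))
        ≡⟨ *-distribʳ-sum (count (inOther C t)) (𝟙 ∘ lookup (A t)) ⟨
      count (lookup (A t)) ℕ.* count (inOther C t)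
        ≡⟨ cong (ℕ._* count (inOther C t)) (aₛ≡count C t) ⟨
      aₛ C t ℕ.* count (inOther C t)
        ∎
      where open ≡-Reasoning

    -- R- and G-optimality together say n - 1 = a_t (a - a_t).
    n∸1≤sum-hits : ∀ t → n ∸ 1 ≤ sum (hits t)
    n∸1≤sum-hits t = begin
      n ∸ 1                           ≡⟨ 1/x≡b/y⇒y≡b*x (aTot C ∸ aₛ C t) (0<aₛ C t) (ℕP.m<n⇒0<n∸m 2≤n)
                                                        (trans (sym (G-opt t)) (R-opt t)) ⟩
      (aTot C ∸ aₛ C t) ℕ.* aₛ C t    ≤⟨ ℕP.*-monoˡ-≤ (aₛ C t)
                                            (ℕP.m≤n+o⇒m∸n≤o (aTot C) (aₛ C t) (aTot≤aₛ+others C t)) ⟩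
      count (inOther C t) ℕ.* aₛ C t  ≡⟨ ℕP.*-comm (count (inOther C t)) (aₛ C t) ⟩
      aₛ C t ℕ.* count (inOther C t)  ≡⟨ sum-hits t ⟨
      sum (hits t)                    ∎
      where open ℕP.≤-Reasoning

    nonzero-shift-hits : ∀ t {d} → d ≢ 𝟘 → ∃ λ g → g ∈ A t × InOther C t (g ⊕ d)
    nonzero-shift-hits t d≢𝟘 =
      let g , hit = count-witness _ (ℕP.n≢0⇒n>0 λ hits≡0 →
                      d≢𝟘 (≤1⇒zero-unique (hits≤1 t) (n∸1≤sum-hits t) hits≡0 (hits-𝟘 t)))
          g∈Aₜ , o = to T-∧ hit
      in g , T⇒∈ g∈Aₜ , o

    -- Landing in A r with r ≠ s would let the shift g' \\ x carry both g and g' out of A s.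
    shift-lands-in : ∀ {s g g' u} → g ∈ A s → g' ∈ A s → g ≢ g' → u ≢ s →
                     ∃ λ x → x ∈ A u × x ⊕ (g' \\ g) ∈ A s
    shift-lands-in {s} {g} {g'} {u} g∈Aₛ g'∈Aₛ g≢g' u≢s
      with nonzero-shift-hits u (g≢g' ∘ sym ∘ x\\y≡𝟘⇒x≡y G)
    ... | x , x∈Aᵤ , hit with other-elim C hit
    ... | r , r≢u , x⊕Δ∈Aᵣ with r ≟ s
    ... | yes refl = x , x∈Aᵤ , x⊕Δ∈Aᵣ
    ... | no  r≢s  = ⊥-elim (g≢g' (collision-free g∈Aₛ g'∈Aₛ hit₁ hit₂))
      where
      hit₁ : InOther C s (g ⊕ (g' \\ x))
      hit₁ = subst (InOther C s) (sym (x∙yz≈z∙yx g (⊖ g') x)) (other-intro C r≢s x⊕Δ∈Aᵣ)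
      hit₂ : InOther C s (g' ⊕ (g' \\ x))
      hit₂ = subst (InOther C s) (sym (\\-leftDividesˡ g' x)) (other-intro C u≢s x∈Aᵤ)

    module _ (ε<1 : ∀ s → ε s < 1ℚ) where

      two-codewords : ∀ s → ∃₂ λ g g' → g ≢ g' × g ∈ A s × g' ∈ A s
      two-codewords s =
        let 1<aₛ = 1/ℕ<1⇒1<k (0<aₛ C s) (subst (_< 1ℚ) (G-opt s) (ε<1 s))
            g , g' , g≢g' , g∈Aₛ , g'∈Aₛ =
              count-two-witnesses (lookup (A s)) (subst (1 ℕ.<_) (aₛ≡count C s) 1<aₛ)
        in g , g' , g≢g' , T⇒∈ g∈Aₛ , T⇒∈ g'∈Aₛ

      no-three-sources : ∀ {s t t'} → t ≢ s → t' ≢ s → t ≢ t' → ⊥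
      no-three-sources {s} {t} {t'} t≢s t'≢s t≢t' with two-codewords s
      ... | g , g' , g≢g' , g∈Aₛ , g'∈Aₛ
          with shift-lands-in g∈Aₛ g'∈Aₛ g≢g' t≢s | shift-lands-in g∈Aₛ g'∈Aₛ g≢g' t'≢s
      ... | x , x∈Aₜ , y∈Aₛ | x' , x'∈Aₜ' , y'∈Aₛ =
        disjoint t t' t≢t' x x∈Aₜ (subst (_∈ A t') (sym x≡x') x'∈Aₜ')
        where
        Δ = g' \\ g
        unshift-hits : ∀ {v z} → v ≢ s → z ∈ A v → InOther C s ((z ⊕ Δ) ⊕ (⊖ Δ))
        unshift-hits v≢s z∈Aᵥ =
          subst (InOther C s) (sym (//-rightDividesʳ Δ _)) (other-intro C v≢s z∈Aᵥ)
        x≡x' : x ≡ x'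
        x≡x' = cancelʳ Δ x x'
                 (collision-free y∈Aₛ y'∈Aₛ (unshift-hits t≢s x∈Aₜ) (unshift-hits t'≢s x'∈Aₜ'))

another : ∀ {m} (s : Fin (suc (suc m))) → ∃ λ t → t ≢ s
another zero    = suc zero , λ ()
another (suc _) = zero , λ ()

mainTheorem19 : (n m : ℕ) → 2 ≤ n → 3 ≤ m → (G : FinAbGroup n) →
  ¬ Σ (AMDCode G m) (λ C → Σ (Fin m → ℚ) (λ ε →
      (∀ s → IsEpsHat C s (ε s)) × (∀ s → ε s < 1ℚ)
      × R-optimal C ε × G-optimal C ε))
mainTheorem19 n _ 2≤n (s≤s (s≤s (s≤s _))) G (C , ε , ε-max , ε<1 , R-opt , G-opt) =
  no-three-sources R-opt 2≤n ε<1 {zero} {suc zero} {suc (suc zero)} (λ ()) (λ ()) (λ ())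
  where open Optimal C ε-max G-opt another
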